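{- Let $B$ be a $2\times 2$ skew-symmetrizable integer matrix with skew-symmetrizer $D=\mathrm{diag}(d_1,d_2)$, whose diagram is an arrow from $v_1$ to $v_2$ of weight $a>0$ (i.e. $b_{12}>0$, $a=-b_{12}b_{21}$), and let $\boldsymbol b=(b_1,b_2)$ be an integer vector. Then: (1) if $a<4$, $\boldsymbol b$ is admissible for any $b_1,b_2$ (not both zero); (2) if $a=4$, $\boldsymbol b$ is admissible if and only if $b_1\le 0\le b_2$ and $d_1b_1^2=d_2b_2^2$ (and $\boldsymbol b\neq 0$); (3) if $a>4$, there are no admissible vectors.
   Context: $B$ skew-symmetrizable means $BD$ is skew-symmetric for a positive integer diagonal $D$. For $\boldsymbol b\in\mathbb Z^n$ form the $(n+1)\times n$ matrix $\widetilde B$ consisting of $B$ with extra last row $-\boldsymbol b$; mutation $\mu_k$ ($1\le k\le n$): $b'_{ij}=-b_{ij}$ if $k\in\{i,j\}$, else $b'_{ij}=b_{ij}+\mathrm{sgn}(b_{ik})[b_{ik}b_{kj}]_+$. $\boldsymbol b$ is admissible if $\boldsymbol b\ne0$ and the mutation class of $\widetilde B$ is finite. -}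

module Defs where

open import Data.Nat using (ℕ; suc)
open import Data.Integer using (ℤ; +_; -_; _+_; _*_; _⊔_; _<_; _>_; 0ℤ; 1ℤ; -1ℤ)
open import Data.Integer.Properties using () renaming (_≟_ to _≟ℤ_)
open import Data.Fin using (Fin; inject₁; fromℕ)
open import Data.Fin.Properties using (_≟_)
open import Data.Vec using (Vec; []; _∷_; lookup; tabulate; replicate; _∷ʳ_; map)
open import Data.Bool using (Bool; true; false; if_then_else_; _∨_)
open import Data.List using (List)
open import Data.List.Membership.Propositional using (_∈_)
open import Data.Product using (Σ; _×_)
open import Relation.Nullary using (¬_)
open import Relation.Nullary.Decidable using (⌊_⌋)
open import Relation.Binary.PropositionalEquality using (_≡_)

Mat : ℕ → ℕ → Set
Mat m n = Vec (Vec ℤ n) m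

entry : ∀ {m n} → Mat m n → Fin m → Fin n → ℤ
entry M i j = lookup (lookup M i) j

sgn : ℤ → ℤ
sgn (+ 0) = 0ℤ
sgn (+ suc _) = 1ℤ
sgn (Data.Integer.-[1+ _ ]) = -1ℤ

[_]₊ : ℤ → ℤ
[ x ]₊ = x ⊔ 0ℤ

extend : ∀ {n} → Mat n n → Vec ℤ n → Mat (suc n) n
extend B b = B ∷ʳ map -_ b

mutate : ∀ {n} → Fin n → Mat (suc n) n → Mat (suc n) n
mutate {n} k M = tabulate λ i → tabulate λ j →
  if ⌊ i ≟ inject₁ k ⌋ ∨ ⌊ j ≟ k ⌋
  then - entry M i j
  else entry M i j + sgn (entry M i k) * [ entry M i k * entry M (inject₁ k) j ]₊

data Reachable {n : ℕ} (M : Mat (suc n) n) : Mat (suc n) n → Set where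
  here : Reachable M M
  step : ∀ {N} (k : Fin n) → Reachable M N → Reachable M (mutate k N)

FiniteMutationClass : ∀ {n} → Mat (suc n) n → Set
FiniteMutationClass {n} M =
  Σ (List (Mat (suc n) n)) λ L → ∀ N → Reachable M N → N ∈ L

Admissible : ∀ {n} → Mat n n → Vec ℤ n → Set
Admissible {n} B b = (¬ b ≡ replicate n 0ℤ) × FiniteMutationClass (extend B b)

IsSkewSymmetrizer : ∀ {n} → Mat n n → Vec ℤ n → Set
IsSkewSymmetrizer {n} B d =
  (∀ i → lookup d i > 0ℤ) ×
  (∀ i j → entry B i j * lookup d j ≡ - (entry B j i * lookup d i))

-- Write B = (0 p ; −q 0) with p, q ≥ 1 and v = −b for the coefficient row of B̃. The two
-- mutations are involutions and their composite μ₁₀ = μ₁ ∘ μ₀ returns the principal part to B,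
-- acting on v by a piecewise-linear map τ; so the mutation class is finite iff the τ-orbit of
-- v is, and it is finite as soon as τ is periodic at v.
--
-- For pq < 4 (the finite types A₂, B₂, G₂) τ is periodic. This is checked on a fan of
-- unimodular cones: on each cone every iterate of τ up to the period is linear, so periodicity
-- is a finite computation on the rays.
--
-- For pq ≥ 4 every orbit enters the quadrant x ≥ 0 ≥ y within two steps. There the sign of
-- δ = p x + 2 y decides: if δ > 0 (or δ = 0, pq > 4 and x > 0) the coordinate x grows without
-- bound along τ, if δ < 0 then −y grows without bound along τ⁻¹, and if δ = 0 and pq = 4 the
-- point is fixed by τ. As τ is injective, an orbit that meets a fixed point starts there. Hence
-- the class is finite iff pq = 4 and p x + 2 y = 0 with x ≥ 0 ≥ y, which by q d₁ = p d₂ is the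
-- condition d₁ b₁² = d₂ b₂² with b₁ ≤ 0 ≤ b₂.

module Submission where

open import Defs
open import Data.Bool using (if_then_else_)
open import Data.Empty using (⊥-elim)
open import Data.Fin using (Fin; zero; suc)
open import Data.Integer
  using (ℤ; NonZero; +_; -[1+_]; +[1+_]; -_; _+_; _-_; _*_; _≤_; _<_; _>_; 0ℤ; 1ℤ; -1ℤ; ∣_∣; +≤+; +<+)
import Data.Integer.Properties as ℤ
open import Data.Integer.Tactic.RingSolver using (solve-∀)
open import Data.List as List using (List; map)
open import Data.List.Extrema ℤ.≤-totalOrder using (max; ⊥≤max; xs≤max)
open import Data.List.Membership.Propositional using (_∈_)
open import Data.List.Membership.Propositional.Properties using (∈-map⁺)
open import Data.List.Relation.Unary.All using () renaming (lookup to lookupAll)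
open import Data.List.Relation.Unary.Any using (here; there)
open import Data.Nat using (ℕ; zero; suc; z≤n; s≤s; z<s; s<s) renaming (_<_ to _<ℕ_; _*_ to _*ℕ_)
import Data.Nat.Properties as ℕ
open import Data.Nat.GeneralisedArithmetic using (fold)
open import Data.Product using (∃; ∃₂; _×_; _,_; proj₁; proj₂)
open import Data.Product.Properties using (≡-dec)
open import Data.Sum using (_⊎_; inj₁; inj₂)
open import Data.Unit using (⊤)
open import Data.Vec using (Vec; []; _∷_)
open import Data.Vec.Properties using (∷-injectiveˡ; ∷-injectiveʳ)
open import Function.Bundles using (_⇔_; mk⇔; Equivalence)
open import Relation.Binary.Definitions using (tri<; tri≈; tri>)
open import Relation.Nullary using (¬_; yes; no; does; contradiction)
open import Relation.Nullary.Decidable using (Dec; True; toWitness; _×-dec_; _⊎-dec_)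
open import Relation.Binary.PropositionalEquality

nonNeg-+ : ∀ {i j} → 0ℤ ≤ i → 0ℤ ≤ j → 0ℤ ≤ i + j
nonNeg-+ = ℤ.+-mono-≤

nonNeg-* : ∀ {i j} → 0ℤ ≤ i → 0ℤ ≤ j → 0ℤ ≤ i * j
nonNeg-* {+ m} {+ n} _ _ = subst (0ℤ ≤_) (ℤ.pos-* m n) (+≤+ z≤n)

nonPos-+ : ∀ {i j} → i ≤ 0ℤ → j ≤ 0ℤ → i + j ≤ 0ℤ
nonPos-+ = ℤ.+-mono-≤

nonPos-* : ∀ {i j} → i ≤ 0ℤ → 0ℤ ≤ j → i * j ≤ 0ℤ
nonPos-* {i} {+ n} i≤0 _ = ℤ.*-monoʳ-≤-nonNeg (+ n) i≤0

positive-* : ∀ {i j} → 1ℤ ≤ i → 1ℤ ≤ j → 1ℤ ≤ i * j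
positive-* {+[1+ m ]} {+[1+ n ]} _ _ = +≤+ (s≤s z≤n)
positive-* {+ zero} (+≤+ ()) _
positive-* {+[1+ m ]} {+ zero} _ (+≤+ ())

half-nonNeg : ∀ i → 0ℤ ≤ + 2 * i → 0ℤ ≤ i
half-nonNeg (+ n)    _ = +≤+ z≤n
half-nonNeg -[1+ n ] ()

half-positive : ∀ i → 1ℤ ≤ + 2 * i → 1ℤ ≤ i
half-positive (+ zero)  (+≤+ ())
half-positive +[1+ n ]  _ = +≤+ (s≤s z≤n)
half-positive -[1+ n ]  ()

≤-by : ∀ {i j} k → 0ℤ ≤ k → j - i ≡ k → i ≤ j
≤-by k 0≤k j-i≡k = ℤ.0≤i-j⇒j≤i (subst (0ℤ ≤_) (sym j-i≡k) 0≤k)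

2*i≡0⇒i≡0 : ∀ {i} → + 2 * i ≡ 0ℤ → i ≡ 0ℤ
2*i≡0⇒i≡0 {+ zero} _ = refl

nonNeg-square-injective : ∀ {i j} → 0ℤ ≤ i → 0ℤ ≤ j → i * i ≡ j * j → i ≡ j
nonNeg-square-injective {+ m} {+ n} _ _ i²≡j² =
  cong +_ (square-injective (ℤ.+-injective (trans (ℤ.pos-* m m) (trans i²≡j² (sym (ℤ.pos-* n n))))))
  where
  square-injective : ∀ {m n} → m *ℕ m ≡ n *ℕ n → m ≡ n
  square-injective {m} {n} m²≡n² with ℕ.<-cmp m n
  ... | tri< m<n _ _ = ⊥-elim (ℕ.<-irrefl m²≡n² (ℕ.*-mono-< m<n m<n))
  ... | tri≈ _ m≡n _ = m≡n
  ... | tri> _ _ m>n = ⊥-elim (ℕ.<-irrefl (sym m²≡n²) (ℕ.*-mono-< m>n m>n))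

*-cancelˡ-≡0 : ∀ i {j} .{{_ : NonZero i}} → i * j ≡ 0ℤ → j ≡ 0ℤ
*-cancelˡ-≡0 i {j} ij≡0 = ℤ.*-cancelˡ-≡ i j 0ℤ (trans ij≡0 (sym (ℤ.*-zeroʳ i)))

fold-fixedPoint : ∀ {A : Set} (f g : A → A) → (∀ x → g (f x) ≡ x) →
                  ∀ {w} → f w ≡ w → ∀ v n → fold v f n ≡ w → v ≡ w
fold-fixedPoint f g g∘f fw≡w v zero    v≡w = v≡w
fold-fixedPoint f g g∘f {w} fw≡w v (suc n) fⁿ⁺¹v≡w =
  fold-fixedPoint f g g∘f fw≡w v n (begin
    fold v f n           ≡⟨ g∘f (fold v f n) ⟨
    g (fold v f (suc n)) ≡⟨ cong g (trans fⁿ⁺¹v≡w (sym fw≡w)) ⟩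
    g (f w)              ≡⟨ g∘f w ⟩
    w                    ∎)
  where open ≡-Reasoning

module Dihedral {A : Set} (s : Fin 2 → A → A) (s-involutive : ∀ k x → s k (s k x) ≡ x) where

  ρ : A → A
  ρ x = s (suc zero) (s zero x)

  data Generated (x : A) : A → Set where
    here : Generated x x
    step : ∀ {y} k → Generated x y → Generated x (s k y)

  Orbit : A → ℕ → A → Set
  Orbit x n y = ∃ λ i → i <ℕ n × (y ≡ fold x ρ i ⊎ y ≡ s zero (fold x ρ i))

  -- Every word in the two involutions reduces to ρⁱ or s₀ ρⁱ, and a period of ρ bounds i.
  generated⇒orbit : ∀ x n → fold x ρ (suc n) ≡ x → ∀ {y} → Generated x y → Orbit x (suc n) y
  generated⇒orbit x n period here = zero , z<s , inj₁ refl
  generated⇒orbit x n period (step zero g) with generated⇒orbit x n period g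
  ... | i , i<1+n , inj₁ y≡ = i , i<1+n , inj₂ (cong (s zero) y≡)
  ... | i , i<1+n , inj₂ y≡ = i , i<1+n , inj₁ (trans (cong (s zero) y≡) (s-involutive zero _))
  generated⇒orbit x n period (step (suc zero) g) with generated⇒orbit x n period g
  ... | zero , _ , inj₁ y≡ =
    n , ℕ.n<1+n n , inj₂ (trans (cong (s (suc zero)) (trans y≡ (sym period))) (s-involutive (suc zero) _))
  ... | suc i , s<s i<n , inj₁ y≡ =
    i , ℕ.m<n⇒m<1+n i<n , inj₂ (trans (cong (s (suc zero)) y≡) (s-involutive (suc zero) _))
  ... | i , i<1+n , inj₂ y≡ with ℕ.m<1+n⇒m<n∨m≡n i<1+n
  ...   | inj₁ i<n  = suc i , s<s i<n , inj₁ (cong (s (suc zero)) y≡)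
  ...   | inj₂ refl = zero , z<s , inj₁ (trans (cong (s (suc zero)) y≡) period)

  orbit : A → ℕ → List A
  orbit x zero    = List.[]
  orbit x (suc i) = fold x ρ i List.∷ s zero (fold x ρ i) List.∷ orbit x i

  ∈-orbit : ∀ x {n y} → Orbit x n y → y ∈ orbit x n
  ∈-orbit x {suc n} (i , i<1+n , y≡) with ℕ.m<1+n⇒m<n∨m≡n i<1+n
  ... | inj₁ i<n = there (there (∈-orbit x (i , i<n , y≡)))
  ∈-orbit x {suc n} (i , _ , inj₁ refl) | inj₂ refl = here refl
  ∈-orbit x {suc n} (i , _ , inj₂ refl) | inj₂ refl = there (here refl)

sgn-neg : ∀ t → sgn (- t) ≡ - sgn t
sgn-neg (+ zero) = refl
sgn-neg +[1+ n ] = refl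
sgn-neg -[1+ n ] = refl

mutationTerm : ℤ → ℤ → ℤ
mutationTerm t c = sgn t * [ t * c ]₊

mutationTerm-neg : ∀ t c → mutationTerm (- t) (- c) ≡ - mutationTerm t c
mutationTerm-neg t c = begin
  sgn (- t) * [ - t * - c ]₊ ≡⟨ cong₂ (λ s u → s * [ u ]₊) (sgn-neg t) (-t*-c≡t*c t c) ⟩
  - sgn t * [ t * c ]₊       ≡⟨ ℤ.neg-distribˡ-* (sgn t) _ ⟨
  - mutationTerm t c         ∎
  where
  open ≡-Reasoning
  -t*-c≡t*c : ∀ t c → - t * - c ≡ t * c
  -t*-c≡t*c = solve-∀

mutationTerm-cancel : ∀ b t c → (b + mutationTerm t c) + mutationTerm (- t) (- c) ≡ b
mutationTerm-cancel b t c rewrite mutationTerm-neg t c = cancel b (mutationTerm t c)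
  where
  cancel : ∀ b m → (b + m) + - m ≡ b
  cancel = solve-∀

mutate-involutive : ∀ k (M : Mat 3 2) → mutate k (mutate k M) ≡ M
mutate-involutive zero ((a ∷ b ∷ []) ∷ (c ∷ d ∷ []) ∷ (e ∷ g ∷ []) ∷ [])
  rewrite ℤ.neg-involutive a | ℤ.neg-involutive b | ℤ.neg-involutive c | ℤ.neg-involutive e
        | mutationTerm-cancel d c b | mutationTerm-cancel g e b = refl
mutate-involutive (suc zero) ((a ∷ b ∷ []) ∷ (c ∷ d ∷ []) ∷ (e ∷ g ∷ []) ∷ [])
  rewrite ℤ.neg-involutive b | ℤ.neg-involutive c | ℤ.neg-involutive d | ℤ.neg-involutive g
        | mutationTerm-cancel a b c | mutationTerm-cancel e g c = refl

μ₁₀ μ₀₁ : Mat 3 2 → Mat 3 2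
μ₁₀ M = mutate (suc zero) (mutate zero M)
μ₀₁ M = mutate zero (mutate (suc zero) M)

μ₀₁∘μ₁₀ : ∀ M → μ₀₁ (μ₁₀ M) ≡ M
μ₀₁∘μ₁₀ M = trans (cong (mutate zero) (mutate-involutive (suc zero) (mutate zero M)))
                  (mutate-involutive zero M)

reachable-μ₁₀ⁿ : ∀ {M N} n → Reachable M N → Reachable M (fold N μ₁₀ n)
reachable-μ₁₀ⁿ zero    r = r
reachable-μ₁₀ⁿ (suc n) r = step (suc zero) (step zero (reachable-μ₁₀ⁿ n r))

reachable-μ₀₁ⁿ : ∀ {M N} n → Reachable M N → Reachable M (fold N μ₀₁ n)
reachable-μ₀₁ⁿ zero    r = r
reachable-μ₀₁ⁿ (suc n) r = step zero (step (suc zero) (reachable-μ₀₁ⁿ n r))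

open Dihedral mutate mutate-involutive using (Generated; here; step; generated⇒orbit; orbit; ∈-orbit)

reachable⇒generated : ∀ {M N} → Reachable M N → Generated M N
reachable⇒generated here       = here
reachable⇒generated (step k r) = step k (reachable⇒generated r)

finite-of-periodic : ∀ M n → fold M μ₁₀ (suc n) ≡ M → FiniteMutationClass M
finite-of-periodic M n period =
  orbit M (suc n) , λ N r → ∈-orbit M (generated⇒orbit M n period (reachable⇒generated r))

infinite-of-unbounded : ∀ {n} (M : Mat (suc n) n) (h : Mat (suc n) n → ℤ) →
  (∀ k → ∃ λ N → Reachable M N × + k ≤ h N) → ¬ FiniteMutationClass M
infinite-of-unbounded M h unbounded (L , complete) =
  let N , r , 1+bound≤hN = unbounded (suc ∣ bound ∣)
  in ℤ.<-irrefl refl (ℤ.<-≤-trans (+<+ (ℕ.n<1+n ∣ bound ∣)) (ℤ.≤-trans 1+bound≤hN (h≤bound N r)))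
  where
  open ℤ.≤-Reasoning
  bound : ℤ
  bound = max 0ℤ (map h L)
  h≤bound : ∀ N → Reachable M N → h N ≤ + ∣ bound ∣
  h≤bound N r = begin
    h N         ≤⟨ lookupAll (xs≤max 0ℤ (map h L)) (∈-map⁺ h (complete N r)) ⟩
    bound       ≡⟨ ℤ.0≤i⇒+∣i∣≡i (⊥≤max 0ℤ (map h L)) ⟨
    + ∣ bound ∣ ∎

mutationTerm-pos : ∀ t n → mutationTerm t +[1+ n ] ≡ +[1+ n ] * [ t ]₊
mutationTerm-pos (+ zero) n = sym (ℤ.*-zeroʳ +[1+ n ])
mutationTerm-pos +[1+ m ] n = trans (ℤ.*-identityˡ (+[1+ m ] * +[1+ n ])) (ℤ.*-comm +[1+ m ] +[1+ n ])
mutationTerm-pos -[1+ m ] n = sym (ℤ.*-zeroʳ +[1+ n ])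

mutationTerm-negative : ∀ t n → mutationTerm t -[1+ n ] ≡ - (+[1+ n ] * [ - t ]₊)
mutationTerm-negative t n = begin
  mutationTerm t -[1+ n ]           ≡⟨ cong (λ s → mutationTerm s -[1+ n ]) (ℤ.neg-involutive t) ⟨
  mutationTerm (- (- t)) -[1+ n ]   ≡⟨ mutationTerm-neg (- t) +[1+ n ] ⟩
  - mutationTerm (- t) +[1+ n ]     ≡⟨ cong -_ (mutationTerm-pos (- t) n) ⟩
  - (+[1+ n ] * [ - t ]₊)           ∎
  where open ≡-Reasoning

-- B̃ for B = (0 p ; −q 0) with p = 1 + P, q = 1 + Q, and last row v = −b.
extended : ℕ → ℕ → ℤ × ℤ → Mat 3 2
extended P Q (x , y) = (0ℤ ∷ +[1+ P ] ∷ []) ∷ (-[1+ Q ] ∷ 0ℤ ∷ []) ∷ (x ∷ y ∷ []) ∷ []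

extended-injective : ∀ {P Q v w} → extended P Q v ≡ extended P Q w → v ≡ w
extended-injective eq =
  cong₂ _,_ (cong (λ M → entry M (suc (suc zero)) zero) eq)
            (cong (λ M → entry M (suc (suc zero)) (suc zero)) eq)

τ : ℤ → ℤ → ℤ × ℤ → ℤ × ℤ
τ p q (x , y) = (- x + q * [ y + p * [ x ]₊ ]₊ , - (y + p * [ x ]₊))

reflect : ℤ × ℤ → ℤ × ℤ
reflect (x , y) = (- y , - x)

reflect-involutive : ∀ v → reflect (reflect v) ≡ v
reflect-involutive (x , y) = cong₂ _,_ (ℤ.neg-involutive x) (ℤ.neg-involutive y)

μ₁₀-extended : ∀ P Q v → μ₁₀ (extended P Q v) ≡ extended P Q (τ +[1+ P ] +[1+ Q ] v)
μ₁₀-extended P Q (x , y)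
  rewrite mutationTerm-pos x P | mutationTerm-pos (y + +[1+ P ] * [ x ]₊) Q = refl

μ₀₁-extended : ∀ P Q v →
  μ₀₁ (extended P Q v) ≡ extended P Q (reflect (τ +[1+ Q ] +[1+ P ] (reflect v)))
μ₀₁-extended P Q (x , y) = begin
  μ₀₁ (extended P Q (x , y))
    ≡⟨ mutated ⟩
  extended P Q (- (x - q * [ - y ]₊) , - y - p * [ - (x - q * [ - y ]₊) ]₊)
    ≡⟨ cong (λ z → extended P Q (z , - y - p * [ z ]₊)) (-[x-z]≡-x+z x (q * [ - y ]₊)) ⟩
  extended P Q (- x + q * [ - y ]₊ , - y - p * [ - x + q * [ - y ]₊ ]₊)
    ≡⟨ cong (extended P Q) (cong₂ _,_ (sym (ℤ.neg-involutive _)) (reflected y _)) ⟩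
  extended P Q (reflect (τ q p (reflect (x , y))))
    ∎
  where
  open ≡-Reasoning
  p q : ℤ
  p = +[1+ P ]
  q = +[1+ Q ]
  mutated : μ₀₁ (extended P Q (x , y)) ≡
            extended P Q (- (x - q * [ - y ]₊) , - y - p * [ - (x - q * [ - y ]₊) ]₊)
  mutated rewrite mutationTerm-negative y Q | mutationTerm-negative (x - q * [ - y ]₊) P = refl
  -[x-z]≡-x+z : ∀ x z → - (x - z) ≡ - x + z
  -[x-z]≡-x+z = solve-∀
  reflected : ∀ y w → - y - w ≡ - (- - y + w)
  reflected = solve-∀

τ-inverse : ∀ P Q v →
  reflect (τ +[1+ Q ] +[1+ P ] (reflect (τ +[1+ P ] +[1+ Q ] v))) ≡ v
τ-inverse P Q v = extended-injective (begin
  extended P Q (reflect (τ q p (reflect (τ p q v)))) ≡⟨ μ₀₁-extended P Q (τ p q v) ⟨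
  μ₀₁ (extended P Q (τ p q v))                       ≡⟨ cong μ₀₁ (μ₁₀-extended P Q v) ⟨
  μ₀₁ (μ₁₀ (extended P Q v))                         ≡⟨ μ₀₁∘μ₁₀ (extended P Q v) ⟩
  extended P Q v                                     ∎)
  where
  open ≡-Reasoning
  p q : ℤ
  p = +[1+ P ]
  q = +[1+ Q ]

μ₁₀ⁿ-extended : ∀ P Q v n →
  fold (extended P Q v) μ₁₀ n ≡ extended P Q (fold v (τ +[1+ P ] +[1+ Q ]) n)
μ₁₀ⁿ-extended P Q v zero    = refl
μ₁₀ⁿ-extended P Q v (suc n) =
  trans (cong μ₁₀ (μ₁₀ⁿ-extended P Q v n)) (μ₁₀-extended P Q (fold v (τ +[1+ P ] +[1+ Q ]) n))

μ₀₁ⁿ-extended : ∀ P Q v n →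
  fold (extended P Q v) μ₀₁ n ≡ extended P Q (reflect (fold (reflect v) (τ +[1+ Q ] +[1+ P ]) n))
μ₀₁ⁿ-extended P Q v zero    = cong (extended P Q) (sym (reflect-involutive v))
μ₀₁ⁿ-extended P Q v (suc n) = begin
  μ₀₁ (fold (extended P Q v) μ₀₁ n)
    ≡⟨ cong μ₀₁ (μ₀₁ⁿ-extended P Q v n) ⟩
  μ₀₁ (extended P Q (reflect w))
    ≡⟨ μ₀₁-extended P Q (reflect w) ⟩
  extended P Q (reflect (τ q p (reflect (reflect w))))
    ≡⟨ cong (λ u → extended P Q (reflect (τ q p u))) (reflect-involutive w) ⟩
  extended P Q (reflect (τ q p w))
    ∎
  where
  open ≡-Reasoning
  p q : ℤ
  p = +[1+ P ]
  q = +[1+ Q ]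
  w : ℤ × ℤ
  w = fold (reflect v) (τ q p) n

-- The linear form a A + b B in the coordinates (A , B) of the cone point A r + B r′.
Form : Set
Form = ℤ × ℤ

⟦_⟧ : Form → ℤ × ℤ → ℤ
⟦ a , b ⟧ (A , B) = a * A + b * B

⟦_⟧² : Form × Form → ℤ × ℤ → ℤ × ℤ
⟦ x , y ⟧² c = (⟦ x ⟧ c , ⟦ y ⟧ c)

infixl 6 _⊕_
infixr 7 _⊛_
infix 8 ⊖_
infix 9 _⁺

_⊕_ : Form → Form → Form
(a , b) ⊕ (c , d) = (a + c , b + d)

_⊛_ : ℤ → Form → Form
k ⊛ (a , b) = (k * a , k * b)

⊖_ : Form → Form
⊖ (a , b) = (- a , - b)

⟦⟧-⊕ : ∀ l m c → ⟦ l ⊕ m ⟧ c ≡ ⟦ l ⟧ c + ⟦ m ⟧ c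
⟦⟧-⊕ (a , b) (c , d) (A , B) = linear a b c d A B
  where
  linear : ∀ a b c d A B → (a + c) * A + (b + d) * B ≡ (a * A + b * B) + (c * A + d * B)
  linear = solve-∀

⟦⟧-⊛ : ∀ k l c → ⟦ k ⊛ l ⟧ c ≡ k * ⟦ l ⟧ c
⟦⟧-⊛ k (a , b) (A , B) = linear k a b A B
  where
  linear : ∀ k a b A B → (k * a) * A + (k * b) * B ≡ k * (a * A + b * B)
  linear = solve-∀

⟦⟧-⊖ : ∀ l c → ⟦ ⊖ l ⟧ c ≡ - ⟦ l ⟧ c
⟦⟧-⊖ (a , b) (A , B) = linear a b A B
  where
  linear : ∀ a b A B → (- a) * A + (- b) * B ≡ - (a * A + b * B)
  linear = solve-∀

NonNeg NonPos SignCoherent : Form → Set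
NonNeg (a , b) = 0ℤ ≤ a × 0ℤ ≤ b
NonPos (a , b) = a ≤ 0ℤ × b ≤ 0ℤ
SignCoherent l = NonNeg l ⊎ NonPos l

nonNeg? : ∀ l → Dec (NonNeg l)
nonNeg? (a , b) = (0ℤ ℤ.≤? a) ×-dec (0ℤ ℤ.≤? b)

signCoherent? : ∀ l → Dec (SignCoherent l)
signCoherent? (a , b) = nonNeg? (a , b) ⊎-dec ((a ℤ.≤? 0ℤ) ×-dec (b ℤ.≤? 0ℤ))

_⁺ : Form → Form
l ⁺ = if does (nonNeg? l) then l else (0ℤ , 0ℤ)

⁺-sound : ∀ {c} → NonNeg c → ∀ l → SignCoherent l → [ ⟦ l ⟧ c ]₊ ≡ ⟦ l ⁺ ⟧ c
⁺-sound {A , B} (0≤A , 0≤B) (a , b) coherent with 0ℤ ℤ.≤? a | 0ℤ ℤ.≤? b | coherent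
... | yes 0≤a | yes 0≤b | _ = ℤ.i≥j⇒i⊔j≡i (nonNeg-+ (nonNeg-* 0≤a 0≤A) (nonNeg-* 0≤b 0≤B))
... | no 0≰a  | _       | inj₁ (0≤a , _) = contradiction 0≤a 0≰a
... | yes _   | no 0≰b  | inj₁ (_ , 0≤b) = contradiction 0≤b 0≰b
... | no _    | _       | inj₂ (a≤0 , b≤0) = ℤ.i≤j⇒i⊔j≡j (nonPos-+ (nonPos-* a≤0 0≤A) (nonPos-* b≤0 0≤B))
... | yes _   | no _    | inj₂ (a≤0 , b≤0) = ℤ.i≤j⇒i⊔j≡j (nonPos-+ (nonPos-* a≤0 0≤A) (nonPos-* b≤0 0≤B))

module Linearisation (p q : ℤ) where

  τᶠ : Form × Form → Form × Form
  τᶠ (x , y) = (⊖ x ⊕ q ⊛ (y ⊕ p ⊛ x ⁺) ⁺ , ⊖ (y ⊕ p ⊛ x ⁺))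

  LinearStep : Form × Form → Set
  LinearStep (x , y) = True (signCoherent? x) × True (signCoherent? (y ⊕ p ⊛ x ⁺))

  τᶠ-sound : ∀ {c} → NonNeg c → ∀ s → LinearStep s → τ p q (⟦ s ⟧² c) ≡ ⟦ τᶠ s ⟧² c
  τᶠ-sound {c} 0≤c (x , y) (coherent-x , coherent-z) = cong₂ _,_ first second
    where
    open ≡-Reasoning
    z : Form
    z = y ⊕ p ⊛ x ⁺
    inner : ⟦ y ⟧ c + p * [ ⟦ x ⟧ c ]₊ ≡ ⟦ z ⟧ c
    inner = begin
      ⟦ y ⟧ c + p * [ ⟦ x ⟧ c ]₊   ≡⟨ cong (λ t → ⟦ y ⟧ c + p * t) (⁺-sound 0≤c x (toWitness coherent-x)) ⟩
      ⟦ y ⟧ c + p * ⟦ x ⁺ ⟧ c      ≡⟨ cong (λ t → ⟦ y ⟧ c + t) (⟦⟧-⊛ p (x ⁺) c) ⟨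
      ⟦ y ⟧ c + ⟦ p ⊛ x ⁺ ⟧ c      ≡⟨ ⟦⟧-⊕ y (p ⊛ x ⁺) c ⟨
      ⟦ z ⟧ c                      ∎
    first : - ⟦ x ⟧ c + q * [ ⟦ y ⟧ c + p * [ ⟦ x ⟧ c ]₊ ]₊ ≡ ⟦ ⊖ x ⊕ q ⊛ z ⁺ ⟧ c
    first = begin
      - ⟦ x ⟧ c + q * [ ⟦ y ⟧ c + p * [ ⟦ x ⟧ c ]₊ ]₊
        ≡⟨ cong (λ t → - ⟦ x ⟧ c + q * [ t ]₊) inner ⟩
      - ⟦ x ⟧ c + q * [ ⟦ z ⟧ c ]₊
        ≡⟨ cong (λ t → - ⟦ x ⟧ c + q * t) (⁺-sound 0≤c z (toWitness coherent-z)) ⟩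
      - ⟦ x ⟧ c + q * ⟦ z ⁺ ⟧ c
        ≡⟨ cong₂ _+_ (⟦⟧-⊖ x c) (⟦⟧-⊛ q (z ⁺) c) ⟨
      ⟦ ⊖ x ⟧ c + ⟦ q ⊛ z ⁺ ⟧ c
        ≡⟨ ⟦⟧-⊕ (⊖ x) (q ⊛ z ⁺) c ⟨
      ⟦ ⊖ x ⊕ q ⊛ z ⁺ ⟧ c
        ∎
    second : - (⟦ y ⟧ c + p * [ ⟦ x ⟧ c ]₊) ≡ ⟦ ⊖ z ⟧ c
    second = trans (cong -_ inner) (sym (⟦⟧-⊖ z c))

  LinearOrbit : ℕ → Form × Form → Set
  LinearOrbit zero    s = ⊤
  LinearOrbit (suc n) s = LinearOrbit n s × LinearStep (fold s τᶠ n)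

  τᶠ-orbit-sound : ∀ {c} → NonNeg c → ∀ n s → LinearOrbit n s →
                   fold (⟦ s ⟧² c) (τ p q) n ≡ ⟦ fold s τᶠ n ⟧² c
  τᶠ-orbit-sound 0≤c zero    s _ = refl
  τᶠ-orbit-sound 0≤c (suc n) s (linear , linearₙ) =
    trans (cong (τ p q) (τᶠ-orbit-sound 0≤c n s linear)) (τᶠ-sound 0≤c (fold s τᶠ n) linearₙ)

  det : ℤ × ℤ → ℤ × ℤ → ℤ
  det (a , b) (c , d) = a * d - b * c

  cone : ℤ × ℤ → ℤ × ℤ → Form × Form
  cone (r₁ , r₂) (r₁′ , r₂′) = ((r₁ , r₁′) , (r₂ , r₂′))

  -- Cramer's rule.
  cone-coordinates : ∀ r r′ v → det r r′ ≡ 1ℤ → ⟦ cone r r′ ⟧² (det v r′ , det r v) ≡ v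
  cone-coordinates (r₁ , r₂) (r₁′ , r₂′) (x , y) unimodular =
    cong₂ _,_ (trans (cramer₁ r₁ r₂ r₁′ r₂′ x y) (trans (cong (_* x) unimodular) (ℤ.*-identityˡ x)))
              (trans (cramer₂ r₁ r₂ r₁′ r₂′ x y) (trans (cong (_* y) unimodular) (ℤ.*-identityˡ y)))
    where
    cramer₁ : ∀ r₁ r₂ r₁′ r₂′ x y →
              r₁ * (x * r₂′ - y * r₁′) + r₁′ * (r₁ * y - r₂ * x) ≡ (r₁ * r₂′ - r₂ * r₁′) * x
    cramer₁ = solve-∀
    cramer₂ : ∀ r₁ r₂ r₁′ r₂′ x y →
              r₂ * (x * r₂′ - y * r₁′) + r₂′ * (r₁ * y - r₂ * x) ≡ (r₁ * r₂′ - r₂ * r₁′) * y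
    cramer₂ = solve-∀

  -- A decidable certificate that τⁿ is the identity on the cone spanned by r and r′: positive
  -- parts are only ever taken of sign-coherent forms, so τⁿ is linear on the cone.
  PeriodicCone : ℕ → ℤ × ℤ → ℤ × ℤ → Set
  PeriodicCone n r r′ = True (det r r′ ℤ.≟ 1ℤ) × LinearOrbit n (cone r r′) ×
                        True (fold (cone r r′) τᶠ n ≟² cone r r′)
    where
    _≟²_ : (s t : Form × Form) → Dec (s ≡ t)
    _≟²_ = ≡-dec (≡-dec ℤ._≟_ ℤ._≟_) (≡-dec ℤ._≟_ ℤ._≟_)

  periodic-on-cone : ∀ n r r′ → PeriodicCone n r r′ →
                     ∀ v → 0ℤ ≤ det r v → 0ℤ ≤ det v r′ → fold v (τ p q) n ≡ v
  periodic-on-cone n r r′ (unimodular , linear , closed) v 0≤B 0≤A = begin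
    fold v (τ p q) n                           ≡⟨ cong (λ u → fold u (τ p q) n) coordinates ⟨
    fold (⟦ cone r r′ ⟧² c) (τ p q) n          ≡⟨ τᶠ-orbit-sound (0≤A , 0≤B) n (cone r r′) linear ⟩
    ⟦ fold (cone r r′) τᶠ n ⟧² c               ≡⟨ cong (λ s → ⟦ s ⟧² c) (toWitness closed) ⟩
    ⟦ cone r r′ ⟧² c                           ≡⟨ coordinates ⟩
    v                                          ∎
    where
    open ≡-Reasoning
    c : ℤ × ℤ
    c = (det v r′ , det r v)
    coordinates : ⟦ cone r r′ ⟧² c ≡ v
    coordinates = cone-coordinates r r′ v (toWitness unimodular)

  Fan : ∀ {k} → ℕ → ℤ × ℤ → Vec (ℤ × ℤ) k → ℤ × ℤ → Set
  Fan n r []        r′ = PeriodicCone n r r′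
  Fan n r (s ∷ rs)  r′ = PeriodicCone n r s × Fan n s rs r′

  periodic-on-fan : ∀ {k} n r (rs : Vec (ℤ × ℤ) k) r′ → Fan n r rs r′ →
                    ∀ v → 0ℤ ≤ det r v → 0ℤ ≤ det v r′ → fold v (τ p q) n ≡ v
  periodic-on-fan n r []       r′ periodic v 0≤det-rv 0≤det-vr′ =
    periodic-on-cone n r r′ periodic v 0≤det-rv 0≤det-vr′
  periodic-on-fan n r (s ∷ rs) r′ (periodic , fan) v 0≤det-rv 0≤det-vr′ with 0ℤ ℤ.≤? det v s
  ... | yes 0≤det-vs = periodic-on-cone n r s periodic v 0≤det-rv 0≤det-vs
  ... | no  0≰det-vs = periodic-on-fan n s rs r′ fan v 0≤det-sv 0≤det-vr′
    where
    antisymmetric : ∀ a b c d → - (a * d - b * c) ≡ c * b - d * a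
    antisymmetric = solve-∀
    0≤det-sv : 0ℤ ≤ det s v
    0≤det-sv = subst (0ℤ ≤_) (antisymmetric (proj₁ v) (proj₂ v) (proj₁ s) (proj₂ s))
                     (ℤ.neg-mono-≤ (ℤ.<⇒≤ (ℤ.≰⇒> 0≰det-vs)))

  periodic-on-plane : ∀ {k l} n (up : Vec (ℤ × ℤ) k) (down : Vec (ℤ × ℤ) l) →
                      Fan n (1ℤ , 0ℤ) up (-1ℤ , 0ℤ) → Fan n (-1ℤ , 0ℤ) down (1ℤ , 0ℤ) →
                      ∀ v → fold v (τ p q) n ≡ v
  periodic-on-plane n up down upper lower (x , y) with 0ℤ ℤ.≤? y
  ... | yes 0≤y = periodic-on-fan n _ up _ upper (x , y)
                    (subst (0ℤ ≤_) (sym (det[e₁,v] x y)) 0≤y) (subst (0ℤ ≤_) (sym (det[v,-e₁] x y)) 0≤y)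
    where
    det[e₁,v] : ∀ x y → 1ℤ * y - 0ℤ * x ≡ y
    det[e₁,v] = solve-∀
    det[v,-e₁] : ∀ x y → x * 0ℤ - y * -1ℤ ≡ y
    det[v,-e₁] = solve-∀
  ... | no 0≰y = periodic-on-fan n _ down _ lower (x , y)
                    (subst (0ℤ ≤_) (sym (det[-e₁,v] x y)) 0≤-y) (subst (0ℤ ≤_) (sym (det[v,e₁] x y)) 0≤-y)
    where
    0≤-y : 0ℤ ≤ - y
    0≤-y = ℤ.neg-mono-≤ (ℤ.<⇒≤ (ℤ.≰⇒> 0≰y))
    det[-e₁,v] : ∀ x y → -1ℤ * y - 0ℤ * x ≡ - y
    det[-e₁,v] = solve-∀
    det[v,e₁] : ∀ x y → x * 0ℤ - y * 1ℤ ≡ - y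
    det[v,e₁] = solve-∀

τ-period-1-1 : ∀ v → fold v (τ 1ℤ 1ℤ) 5 ≡ v
τ-period-1-1 = Linearisation.periodic-on-plane 1ℤ 1ℤ 5
  ((0ℤ , 1ℤ) ∷ []) ((0ℤ , -1ℤ) ∷ (1ℤ , -1ℤ) ∷ []) _ _

τ-period-1-2 : ∀ v → fold v (τ 1ℤ (+ 2)) 3 ≡ v
τ-period-1-2 = Linearisation.periodic-on-plane 1ℤ (+ 2) 3
  ((0ℤ , 1ℤ) ∷ []) ((0ℤ , -1ℤ) ∷ (1ℤ , -1ℤ) ∷ (+ 2 , -1ℤ) ∷ []) _ _

τ-period-2-1 : ∀ v → fold v (τ (+ 2) 1ℤ) 3 ≡ v
τ-period-2-1 = Linearisation.periodic-on-plane (+ 2) 1ℤ 3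
  ((0ℤ , 1ℤ) ∷ []) ((0ℤ , -1ℤ) ∷ (1ℤ , - + 2) ∷ (1ℤ , -1ℤ) ∷ []) _ _

τ-period-1-3 : ∀ v → fold v (τ 1ℤ (+ 3)) 4 ≡ v
τ-period-1-3 = Linearisation.periodic-on-plane 1ℤ (+ 3) 4
  ((0ℤ , 1ℤ) ∷ []) ((0ℤ , -1ℤ) ∷ (1ℤ , -1ℤ) ∷ (+ 3 , - + 2) ∷ (+ 2 , -1ℤ) ∷ (+ 3 , -1ℤ) ∷ []) _ _

τ-period-3-1 : ∀ v → fold v (τ (+ 3) 1ℤ) 4 ≡ v
τ-period-3-1 = Linearisation.periodic-on-plane (+ 3) 1ℤ 4
  ((0ℤ , 1ℤ) ∷ []) ((0ℤ , -1ℤ) ∷ (1ℤ , - + 3) ∷ (1ℤ , - + 2) ∷ (+ 2 , - + 3) ∷ (1ℤ , -1ℤ) ∷ []) _ _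

finite-of-τ-periodic : ∀ P Q n → (∀ v → fold v (τ +[1+ P ] +[1+ Q ]) (suc n) ≡ v) →
                       ∀ v → FiniteMutationClass (extended P Q v)
finite-of-τ-periodic P Q n period v =
  finite-of-periodic _ n (trans (μ₁₀ⁿ-extended P Q v (suc n)) (cong (extended P Q) (period v)))

finite-of-small : ∀ P Q → +[1+ P ] * +[1+ Q ] < + 4 → ∀ v → FiniteMutationClass (extended P Q v)
finite-of-small 0 0 _ = finite-of-τ-periodic 0 0 4 τ-period-1-1
finite-of-small 0 1 _ = finite-of-τ-periodic 0 1 2 τ-period-1-2
finite-of-small 1 0 _ = finite-of-τ-periodic 1 0 2 τ-period-2-1
finite-of-small 0 2 _ = finite-of-τ-periodic 0 2 3 τ-period-1-3
finite-of-small 2 0 _ = finite-of-τ-periodic 2 0 3 τ-period-3-1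
finite-of-small 0 (suc (suc (suc Q))) (+<+ (s≤s (s≤s (s≤s (s≤s ())))))
finite-of-small (suc (suc (suc P))) 0 (+<+ (s≤s (s≤s (s≤s (s≤s ())))))
finite-of-small (suc P) (suc Q) (+<+ pq<4) =
  ⊥-elim (ℕ.<-irrefl refl (ℕ.<-≤-trans pq<4
    (ℕ.*-mono-≤ {2} {suc (suc P)} {2} {suc (suc Q)} (s≤s (s≤s z≤n)) (s≤s (s≤s z≤n)))))

Quadrant : ℤ × ℤ → Set
Quadrant (x , y) = 0ℤ ≤ x × y ≤ 0ℤ

δ : ℤ → ℤ × ℤ → ℤ
δ p (x , y) = p * x + + 2 * y

Balanced : ℤ → ℤ × ℤ → Set
Balanced p v = Quadrant v × δ p v ≡ 0ℤ

-- For (x′ , y′) = τ (x , y) one has 2 (x′ − x) = (pq − 4) x + q δ, and δ does not decrease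
-- along τ, so on Expanding points x grows by at least one per step.
Expanding : ℤ → ℤ → ℤ × ℤ → Set
Expanding p q (x , y) = Quadrant (x , y) × 0ℤ ≤ δ p (x , y) × 1ℤ ≤ (p * q - + 4) * x + q * δ p (x , y)

Balanced∧small⇒zero : ∀ p K {v} → 1ℤ ≤ K → Balanced p v → K * proj₁ v < 1ℤ → v ≡ (0ℤ , 0ℤ)
Balanced∧small⇒zero p K {+ zero , y} _ (_ , δ≡0) _ =
  cong (0ℤ ,_) (2*i≡0⇒i≡0 (trans (sym (p*0+i≡i p (+ 2 * y))) δ≡0))
  where
  p*0+i≡i : ∀ p i → p * 0ℤ + i ≡ i
  p*0+i≡i = solve-∀
Balanced∧small⇒zero p K {+[1+ n ] , y} 1≤K _ Kx<1 =
  ⊥-elim (ℤ.<⇒≱ Kx<1 (positive-* 1≤K (+≤+ (s≤s z≤n))))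

module Dynamics (p q : ℤ) (1≤p : 1ℤ ≤ p) (1≤q : 1ℤ ≤ q) where

  0≤p : 0ℤ ≤ p
  0≤p = ℤ.≤-trans (+≤+ z≤n) 1≤p

  0≤q : 0ℤ ≤ q
  0≤q = ℤ.≤-trans (+≤+ z≤n) 1≤q

  τ-nonNeg : ∀ x y → 0ℤ ≤ x → 0ℤ ≤ y + p * x →
             τ p q (x , y) ≡ (- x + q * (y + p * x) , - (y + p * x))
  τ-nonNeg x y 0≤x 0≤y+px rewrite ℤ.i≥j⇒i⊔j≡i 0≤x | ℤ.i≥j⇒i⊔j≡i 0≤y+px = refl

  τ-nonPos : ∀ x y → x ≤ 0ℤ → τ p q (x , y) ≡ (- x + q * [ y ]₊ , - y)
  τ-nonPos x y x≤0 rewrite ℤ.i≤j⇒i⊔j≡j x≤0 | ℤ.*-zeroʳ p | ℤ.+-identityʳ y = refl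

  τ-upper⇒Quadrant : ∀ x y → 0ℤ ≤ y → Quadrant (τ p q (x , y))
  τ-upper⇒Quadrant x y 0≤y with 0ℤ ℤ.≤? x
  ... | yes 0≤x = subst Quadrant (sym (τ-nonNeg x y 0≤x 0≤y+px))
        (subst (0ℤ ≤_) (sym (expand p q x y)) (nonNeg-+ (nonNeg-* 0≤pq-1 0≤x) (nonNeg-* 0≤q 0≤y)) ,
         ℤ.neg-mono-≤ 0≤y+px)
    where
    0≤y+px : 0ℤ ≤ y + p * x
    0≤y+px = nonNeg-+ 0≤y (nonNeg-* 0≤p 0≤x)
    0≤pq-1 : 0ℤ ≤ p * q - 1ℤ
    0≤pq-1 = ℤ.i≤j⇒0≤j-i (positive-* 1≤p 1≤q)
    expand : ∀ p q x y → - x + q * (y + p * x) ≡ (p * q - 1ℤ) * x + q * y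
    expand = solve-∀
  ... | no 0≰x = subst Quadrant (sym (τ-nonPos x y x≤0))
        (nonNeg-+ (ℤ.neg-mono-≤ x≤0) (nonNeg-* 0≤q (ℤ.i≤j⊔i y 0ℤ)) ,
         ℤ.neg-mono-≤ 0≤y)
    where
    x≤0 : x ≤ 0ℤ
    x≤0 = ℤ.<⇒≤ (ℤ.≰⇒> 0≰x)

  τ-thirdQuadrant⇒upper : ∀ x y → x ≤ 0ℤ → y ≤ 0ℤ → 0ℤ ≤ proj₂ (τ p q (x , y))
  τ-thirdQuadrant⇒upper x y x≤0 y≤0 =
    subst (λ v → 0ℤ ≤ proj₂ v) (sym (τ-nonPos x y x≤0)) (ℤ.neg-mono-≤ y≤0)

  eventually-Quadrant : ∀ v → ∃ λ k → Quadrant (fold v (τ p q) k)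
  eventually-Quadrant (x , y) with 0ℤ ℤ.≤? y | 0ℤ ℤ.≤? x
  ... | yes 0≤y | _       = 1 , τ-upper⇒Quadrant x y 0≤y
  ... | no y≱0  | yes 0≤x = 0 , 0≤x , ℤ.<⇒≤ (ℤ.≰⇒> y≱0)
  ... | no y≱0  | no x≱0  = 2 , τ-upper⇒Quadrant _ _
          (τ-thirdQuadrant⇒upper x y (ℤ.<⇒≤ (ℤ.≰⇒> x≱0)) (ℤ.<⇒≤ (ℤ.≰⇒> y≱0)))

  0≤y+px : ∀ x y → 0ℤ ≤ x → 0ℤ ≤ δ p (x , y) → 0ℤ ≤ y + p * x
  0≤y+px x y 0≤x 0≤δ =
    half-nonNeg _ (subst (0ℤ ≤_) (sym (double p x y)) (nonNeg-+ 0≤δ (nonNeg-* 0≤p 0≤x)))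
    where
    double : ∀ p x y → + 2 * (y + p * x) ≡ (p * x + + 2 * y) + p * x
    double = solve-∀

  τ-balanced : p * q ≡ + 4 → ∀ {v} → Balanced p v → τ p q v ≡ v
  τ-balanced pq≡4 {x , y} ((0≤x , _) , δ≡0) =
    trans (τ-nonNeg x y 0≤x (0≤y+px x y 0≤x (ℤ.≤-reflexive (sym δ≡0))))
          (cong₂ _,_ (ℤ.i-j≡0⇒i≡j _ _ (2*i≡0⇒i≡0 (begin
                        + 2 * ((- x + q * (y + p * x)) - x)  ≡⟨ Δx p q x y ⟩
                        (p * q - + 4) * x + q * δ p (x , y)
                          ≡⟨ cong₂ (λ a d → (a - + 4) * x + q * d) pq≡4 δ≡0 ⟩
                        0ℤ * x + q * 0ℤ                       ≡⟨ zero-sum x q ⟩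
                        0ℤ                                    ∎)))
                     (ℤ.i-j≡0⇒i≡j _ _ (trans (Δy p x y) (cong -_ δ≡0))))
    where
    open ≡-Reasoning
    Δx : ∀ p q x y → + 2 * ((- x + q * (y + p * x)) - x) ≡ (p * q - + 4) * x + q * (p * x + + 2 * y)
    Δx = solve-∀
    Δy : ∀ p x y → - (y + p * x) - y ≡ - (p * x + + 2 * y)
    Δy = solve-∀
    zero-sum : ∀ x q → 0ℤ * x + q * 0ℤ ≡ 0ℤ
    zero-sum = solve-∀

  module _ (4≤pq : + 4 ≤ p * q) where

    0≤pq-4 : 0ℤ ≤ p * q - + 4
    0≤pq-4 = ℤ.i≤j⇒0≤j-i 4≤pq

    expanding-step : ∀ {v} → Expanding p q v →
                     Expanding p q (τ p q v) × proj₁ v + 1ℤ ≤ proj₁ (τ p q v)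
    expanding-step {x , y} ((0≤x , y≤0) , 0≤δ , 1≤H) =
      subst (λ w → Expanding p q w × x + 1ℤ ≤ proj₁ w) (sym (τ-nonNeg x y 0≤x 0≤y'))
        (((0≤x' , ℤ.neg-mono-≤ 0≤y') , ℤ.≤-trans 0≤δ δ≤δ' , ℤ.≤-trans 1≤H H≤H') , x+1≤x')
      where
      y' x' : ℤ
      y' = y + p * x
      x' = - x + q * y'
      0≤y' : 0ℤ ≤ y'
      0≤y' = 0≤y+px x y 0≤x 0≤δ
      Δx : ∀ p q x y → + 2 * ((- x + q * (y + p * x)) - x) ≡ (p * q - + 4) * x + q * (p * x + + 2 * y)
      Δx = solve-∀
      Δδ : ∀ p q x y → (p * (- x + q * (y + p * x)) + + 2 * (- (y + p * x))) - (p * x + + 2 * y)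
                       ≡ (p * q - + 4) * (y + p * x)
      Δδ = solve-∀
      ΔH : ∀ K q x x' d d' → (K * x' + q * d') - (K * x + q * d) ≡ K * (x' - x) + q * (d' - d)
      ΔH = solve-∀
      shift : ∀ x x' → x' - (x + 1ℤ) ≡ (x' - x) - 1ℤ
      shift = solve-∀
      1≤x'-x : 1ℤ ≤ x' - x
      1≤x'-x = half-positive _ (subst (1ℤ ≤_) (sym (Δx p q x y)) 1≤H)
      x+1≤x' : x + 1ℤ ≤ x'
      x+1≤x' = ≤-by _ (ℤ.i≤j⇒0≤j-i 1≤x'-x) (shift x x')
      0≤x' : 0ℤ ≤ x'
      0≤x' = ℤ.≤-trans 0≤x (ℤ.≤-trans (ℤ.i≤i+j x 1ℤ) x+1≤x')
      δ≤δ' : δ p (x , y) ≤ δ p (x' , - y')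
      δ≤δ' = ≤-by _ (nonNeg-* 0≤pq-4 0≤y') (Δδ p q x y)
      H≤H' : (p * q - + 4) * x + q * δ p (x , y) ≤ (p * q - + 4) * x' + q * δ p (x' , - y')
      H≤H' = ≤-by _ (nonNeg-+ (nonNeg-* 0≤pq-4 (ℤ.≤-trans (+≤+ z≤n) 1≤x'-x))
                              (nonNeg-* 0≤q (ℤ.i≤j⇒0≤j-i δ≤δ')))
                  (ΔH (p * q - + 4) q x x' (δ p (x , y)) (δ p (x' , - y')))

    expanding-orbit : ∀ {v} → Expanding p q v → ∀ n →
                      Expanding p q (fold v (τ p q) n) × + n ≤ proj₁ (fold v (τ p q) n)
    expanding-orbit {v} exp zero = exp , proj₁ (proj₁ exp)
    expanding-orbit {v} exp (suc n) =
      let expₙ , n≤xₙ = expanding-orbit exp n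
          expₙ₊₁ , xₙ+1≤xₙ₊₁ = expanding-step expₙ
      in expₙ₊₁ , ℤ.≤-trans (+-monoˡ-suc n≤xₙ) xₙ+1≤xₙ₊₁
      where
      +-monoˡ-suc : ∀ {n i} → + n ≤ i → + suc n ≤ i + 1ℤ
      +-monoˡ-suc {n} {i} n≤i = subst (_≤ i + 1ℤ) (ℤ.+-comm (+ n) 1ℤ) (ℤ.+-monoˡ-≤ 1ℤ n≤i)

    Quadrant-trichotomy : ∀ {v} → Quadrant v →
      Expanding p q v ⊎ Expanding q p (reflect v) ⊎ (Balanced p v × (p * q - + 4) * proj₁ v < 1ℤ)
    Quadrant-trichotomy {x , y} (0≤x , y≤0) with ℤ.<-cmp (δ p (x , y)) 0ℤ
    ... | tri> _ _ δ>0 = inj₁ ((0≤x , y≤0) , ℤ.<⇒≤ δ>0 ,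
          ℤ.+-mono-≤ (nonNeg-* 0≤pq-4 0≤x) (positive-* 1≤q (ℤ.i<j⇒suc[i]≤j δ>0)))
    ... | tri< δ<0 _ _ = inj₂ (inj₁ ((ℤ.neg-mono-≤ y≤0 , ℤ.neg-mono-≤ 0≤x) , ℤ.≤-trans (+≤+ z≤n) 1≤δ' ,
          ℤ.+-mono-≤ (nonNeg-* 0≤qp-4 (ℤ.neg-mono-≤ y≤0)) (positive-* 1≤p 1≤δ')))
      where
      0≤qp-4 : 0ℤ ≤ q * p - + 4
      0≤qp-4 = subst (λ r → 0ℤ ≤ r - + 4) (ℤ.*-comm p q) 0≤pq-4
      dual : ∀ p q x y → + 2 * (q * (- y) + + 2 * (- x)) ≡ (p * q - + 4) * x + q * (- (p * x + + 2 * y))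
      dual = solve-∀
      1≤δ' : 1ℤ ≤ δ q (- y , - x)
      1≤δ' = half-positive _ (subst (1ℤ ≤_) (sym (dual p q x y))
               (ℤ.+-mono-≤ (nonNeg-* 0≤pq-4 0≤x) (positive-* 1≤q (ℤ.i<j⇒suc[i]≤j (ℤ.neg-mono-< δ<0)))))
    ... | tri≈ _ δ≡0 _ with 1ℤ ℤ.≤? (p * q - + 4) * x
    ...   | yes 1≤Kx = inj₁ ((0≤x , y≤0) , ℤ.≤-reflexive (sym δ≡0) , subst (1ℤ ≤_) (sym H≡Kx) 1≤Kx)
      where
      H≡Kx : (p * q - + 4) * x + q * δ p (x , y) ≡ (p * q - + 4) * x
      H≡Kx = trans (cong (λ d → (p * q - + 4) * x + q * d) δ≡0)
                   (trans (cong (λ r → (p * q - + 4) * x + r) (ℤ.*-zeroʳ q)) (ℤ.+-identityʳ _))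
    ...   | no 1≰Kx = inj₂ (inj₂ (((0≤x , y≤0) , δ≡0) , ℤ.≰⇒> 1≰Kx))

module Classification (P Q : ℕ) where

  p q : ℤ
  p = +[1+ P ]
  q = +[1+ Q ]

  open Dynamics p q (+≤+ (s≤s z≤n)) (+≤+ (s≤s z≤n))
  open Dynamics q p (+≤+ (s≤s z≤n)) (+≤+ (s≤s z≤n)) using () renaming (expanding-orbit to expanding-orbit′)

  reachable-τⁿ : ∀ v n → Reachable (extended P Q v) (extended P Q (fold v (τ p q) n))
  reachable-τⁿ v n = subst (Reachable _) (μ₁₀ⁿ-extended P Q v n) (reachable-μ₁₀ⁿ n here)

  module _ (4≤pq : + 4 ≤ p * q) where

    Expanding⇒infinite : ∀ {M w} → Expanding p q w → Reachable M (extended P Q w) →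
                         ¬ FiniteMutationClass M
    Expanding⇒infinite {M} {w} exp r = infinite-of-unbounded M (λ N → entry N (suc (suc zero)) zero) λ n →
      extended P Q (fold w (τ p q) n) ,
      subst (Reachable M) (μ₁₀ⁿ-extended P Q w n) (reachable-μ₁₀ⁿ n r) ,
      proj₂ (expanding-orbit 4≤pq exp n)

    reflect-Expanding⇒infinite : ∀ {M w} → Expanding q p (reflect w) → Reachable M (extended P Q w) →
                                 ¬ FiniteMutationClass M
    reflect-Expanding⇒infinite {M} {w} exp r =
      infinite-of-unbounded M (λ N → - entry N (suc (suc zero)) (suc zero)) λ n →
        extended P Q (reflect (fold (reflect w) (τ q p) n)) ,
        subst (Reachable M) (μ₀₁ⁿ-extended P Q w n) (reachable-μ₀₁ⁿ n r) ,
        subst (+ n ≤_) (sym (ℤ.neg-involutive _)) (proj₂ (expanding-orbit′ 4≤qp exp n))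
      where
      4≤qp : + 4 ≤ q * p
      4≤qp = subst (+ 4 ≤_) (ℤ.*-comm p q) 4≤pq

    finite⇒balanced-iterate : ∀ v → FiniteMutationClass (extended P Q v) →
      ∃ λ k → Balanced p (fold v (τ p q) k) × (p * q - + 4) * proj₁ (fold v (τ p q) k) < 1ℤ
    finite⇒balanced-iterate v finite with eventually-Quadrant v
    ... | k , quadrant with Quadrant-trichotomy 4≤pq quadrant
    ...   | inj₁ expanding        = ⊥-elim (Expanding⇒infinite expanding (reachable-τⁿ v k) finite)
    ...   | inj₂ (inj₁ expanding) = ⊥-elim (reflect-Expanding⇒infinite expanding (reachable-τⁿ v k) finite)
    ...   | inj₂ (inj₂ balanced)  = k , balanced

  τ-orbit-fixedPoint : ∀ {w} → τ p q w ≡ w → ∀ v n → fold v (τ p q) n ≡ w → v ≡ w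
  τ-orbit-fixedPoint = fold-fixedPoint (τ p q) (λ u → reflect (τ q p (reflect u))) (τ-inverse P Q)

  finite⇔balanced : p * q ≡ + 4 → ∀ v → FiniteMutationClass (extended P Q v) ⇔ Balanced p v
  finite⇔balanced pq≡4 v = mk⇔ only-if if
    where
    only-if : FiniteMutationClass (extended P Q v) → Balanced p v
    only-if finite with finite⇒balanced-iterate (ℤ.≤-reflexive (sym pq≡4)) v finite
    ... | k , bal , _ = subst (Balanced p) (sym (τ-orbit-fixedPoint (τ-balanced pq≡4 bal) v k refl)) bal
    if : Balanced p v → FiniteMutationClass (extended P Q v)
    if bal = finite-of-periodic (extended P Q v) 0
               (trans (μ₁₀-extended P Q v) (cong (extended P Q) (τ-balanced pq≡4 bal)))

  τ-zero : τ p q (0ℤ , 0ℤ) ≡ (0ℤ , 0ℤ)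
  τ-zero rewrite ℤ.*-zeroʳ p | ℤ.*-zeroʳ q = refl

  infinite-of-large : + 5 ≤ p * q → ∀ v → ¬ v ≡ (0ℤ , 0ℤ) → ¬ FiniteMutationClass (extended P Q v)
  infinite-of-large 5≤pq v v≢0 finite =
    let k , bal , Kx<1 = finite⇒balanced-iterate 4≤pq v finite
        vₖ≡0 = Balanced∧small⇒zero p (p * q - + 4) 1≤pq-4 bal Kx<1
    in v≢0 (τ-orbit-fixedPoint τ-zero v k vₖ≡0)
    where
    4≤pq : + 4 ≤ p * q
    4≤pq = ℤ.≤-trans (+≤+ (s≤s (s≤s (s≤s (s≤s z≤n))))) 5≤pq
    1≤pq-4 : 1ℤ ≤ p * q - + 4
    1≤pq-4 = ℤ.+-monoˡ-≤ (- + 4) 5≤pq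

rank2 : ℕ → ℕ → Mat 2 2
rank2 P Q = (0ℤ ∷ +[1+ P ] ∷ []) ∷ (-[1+ Q ] ∷ 0ℤ ∷ []) ∷ []

positive⇒+[1+_] : ∀ {d} → 0ℤ < d → ∃ λ e → d ≡ +[1+ e ]
positive⇒+[1+_] {+[1+ e ]} _ = e , refl
positive⇒+[1+_] {+ zero} (+<+ ())

skew-diagonal : ∀ b e → b * +[1+ e ] ≡ - (b * +[1+ e ]) → b ≡ 0ℤ
skew-diagonal b e bd≡-bd with ℤ.i*j≡0⇒i≡0∨j≡0 b (i≡-i⇒i≡0 bd≡-bd)
  where
  i≡-i⇒i≡0 : ∀ {i} → i ≡ - i → i ≡ 0ℤ
  i≡-i⇒i≡0 {+ zero} _ = refl
... | inj₁ b≡0 = b≡0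

skew-offDiagonal : ∀ b e₁ P e₂ → b * +[1+ e₁ ] ≡ - (+[1+ P ] * +[1+ e₂ ]) → ∃ λ Q → b ≡ -[1+ Q ]
skew-offDiagonal -[1+ Q ] _ _ _ _ = Q , refl
skew-offDiagonal (+ zero)  _ _ _ ()
skew-offDiagonal +[1+ _ ]  _ _ _ ()

rank2-shape : ∀ B d₁ d₂ → IsSkewSymmetrizer B (d₁ ∷ d₂ ∷ []) → entry B zero (suc zero) > 0ℤ →
  ∃₂ λ P Q → ∃₂ λ e₁ e₂ → B ≡ rank2 P Q × d₁ ≡ +[1+ e₁ ] × d₂ ≡ +[1+ e₂ ]
rank2-shape ((b₁₁ ∷ b₁₂ ∷ []) ∷ (b₂₁ ∷ b₂₂ ∷ []) ∷ []) d₁ d₂ (positive , skew) b₁₂>0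
  with positive⇒+[1+_] (positive zero) | positive⇒+[1+_] (positive (suc zero)) | positive⇒+[1+_] b₁₂>0
... | e₁ , refl | e₂ , refl | P , refl with skew-offDiagonal b₂₁ e₁ P e₂ (skew (suc zero) zero)
... | Q , refl
  rewrite skew-diagonal b₁₁ e₁ (skew zero zero) | skew-diagonal b₂₂ e₂ (skew (suc zero) (suc zero)) =
  P , Q , e₁ , e₂ , refl , refl , refl

module Weights (P Q E₁ E₂ : ℕ) where

  p q d₁ d₂ : ℤ
  p  = +[1+ P ]
  q  = +[1+ Q ]
  d₁ = +[1+ E₁ ]
  d₂ = +[1+ E₂ ]

  module _ (pq≡4 : p * q ≡ + 4) (qd₁≡pd₂ : q * d₁ ≡ p * d₂) where

    squares-gap : ∀ b₁ b₂ → p * d₁ * ((p * b₁) * (p * b₁) - (+ 2 * b₂) * (+ 2 * b₂))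
                            ≡ p * p * p * (d₁ * (b₁ * b₁) - d₂ * (b₂ * b₂))
    squares-gap b₁ b₂ = begin
      p * d₁ * ((p * b₁) * (p * b₁) - (+ 2 * b₂) * (+ 2 * b₂))
        ≡⟨ expand p q d₁ d₂ b₁ b₂ ⟩
      p * p * p * X + p * p * (b₂ * b₂) * (p * d₂ - q * d₁) + p * d₁ * (b₂ * b₂) * (p * q - + 4)
        ≡⟨ cong₂ (λ u w → p * p * p * X + p * p * (b₂ * b₂) * u + p * d₁ * (b₂ * b₂) * w)
                 (ℤ.i≡j⇒i-j≡0 (sym qd₁≡pd₂)) (ℤ.i≡j⇒i-j≡0 pq≡4) ⟩
      p * p * p * X + p * p * (b₂ * b₂) * 0ℤ + p * d₁ * (b₂ * b₂) * 0ℤ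
        ≡⟨ drop (p * p * p * X) (p * p * (b₂ * b₂)) (p * d₁ * (b₂ * b₂)) ⟩
      p * p * p * X
        ∎
      where
      open ≡-Reasoning
      X : ℤ
      X = d₁ * (b₁ * b₁) - d₂ * (b₂ * b₂)
      expand : ∀ p q d₁ d₂ b₁ b₂ →
        p * d₁ * ((p * b₁) * (p * b₁) - (+ 2 * b₂) * (+ 2 * b₂))
        ≡ p * p * p * (d₁ * (b₁ * b₁) - d₂ * (b₂ * b₂)) + p * p * (b₂ * b₂) * (p * d₂ - q * d₁)
          + p * d₁ * (b₂ * b₂) * (p * q - + 4)
      expand = solve-∀
      drop : ∀ a b c → a + b * 0ℤ + c * 0ℤ ≡ a
      drop = solve-∀

    Balanced⇔weighted : ∀ b₁ b₂ → Balanced p (- b₁ , - b₂) ⇔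
                        (b₁ ≤ 0ℤ × 0ℤ ≤ b₂ × d₁ * (b₁ * b₁) ≡ d₂ * (b₂ * b₂))
    Balanced⇔weighted b₁ b₂ = mk⇔ to from
      where
      to : Balanced p (- b₁ , - b₂) → b₁ ≤ 0ℤ × 0ℤ ≤ b₂ × d₁ * (b₁ * b₁) ≡ d₂ * (b₂ * b₂)
      to ((0≤-b₁ , -b₂≤0) , δ≡0) = ℤ.neg-cancel-≤ 0≤-b₁ , ℤ.neg-cancel-≤ -b₂≤0 ,
        ℤ.i-j≡0⇒i≡j _ _ (*-cancelˡ-≡0 (p * p * p) (begin
          p * p * p * (d₁ * (b₁ * b₁) - d₂ * (b₂ * b₂))
            ≡⟨ squares-gap b₁ b₂ ⟨
          p * d₁ * ((p * b₁) * (p * b₁) - (+ 2 * b₂) * (+ 2 * b₂))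
            ≡⟨ cong (p * d₁ *_) (difference-of-squares p b₁ b₂) ⟩
          p * d₁ * (- δ p (- b₁ , - b₂) * (p * b₁ - + 2 * b₂))
            ≡⟨ cong (λ t → p * d₁ * (- t * (p * b₁ - + 2 * b₂))) δ≡0 ⟩
          p * d₁ * (0ℤ * (p * b₁ - + 2 * b₂))
            ≡⟨ ℤ.*-zeroʳ (p * d₁) ⟩
          0ℤ
            ∎))
        where
        open ≡-Reasoning
        difference-of-squares : ∀ p b₁ b₂ → (p * b₁) * (p * b₁) - (+ 2 * b₂) * (+ 2 * b₂)
                                ≡ - (p * - b₁ + + 2 * - b₂) * (p * b₁ - + 2 * b₂)
        difference-of-squares = solve-∀
      from : b₁ ≤ 0ℤ × 0ℤ ≤ b₂ × d₁ * (b₁ * b₁) ≡ d₂ * (b₂ * b₂) → Balanced p (- b₁ , - b₂)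
      from (b₁≤0 , 0≤b₂ , weighted) = (ℤ.neg-mono-≤ b₁≤0 , ℤ.neg-mono-≤ 0≤b₂) , (begin
        p * - b₁ + + 2 * - b₂  ≡⟨ cong (λ t → t + + 2 * - b₂) p[-b₁]≡2b₂ ⟩
        + 2 * b₂ + + 2 * - b₂  ≡⟨ cancel b₂ ⟩
        0ℤ                     ∎)
        where
        open ≡-Reasoning
        cancel : ∀ b → + 2 * b + + 2 * - b ≡ 0ℤ
        cancel = solve-∀
        squares : ∀ p b₁ b₂ → (p * - b₁) * (p * - b₁) - (+ 2 * b₂) * (+ 2 * b₂)
                              ≡ (p * b₁) * (p * b₁) - (+ 2 * b₂) * (+ 2 * b₂)
        squares = solve-∀
        p[-b₁]≡2b₂ : p * - b₁ ≡ + 2 * b₂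
        p[-b₁]≡2b₂ = nonNeg-square-injective
          (nonNeg-* {p} { - b₁} (+≤+ z≤n) (ℤ.neg-mono-≤ b₁≤0)) (nonNeg-* {+ 2} {b₂} (+≤+ z≤n) 0≤b₂)
          (ℤ.i-j≡0⇒i≡j _ _ (trans (squares p b₁ b₂) (*-cancelˡ-≡0 (p * d₁) (begin
            p * d₁ * ((p * b₁) * (p * b₁) - (+ 2 * b₂) * (+ 2 * b₂))
              ≡⟨ squares-gap b₁ b₂ ⟩
            p * p * p * (d₁ * (b₁ * b₁) - d₂ * (b₂ * b₂))
              ≡⟨ cong (p * p * p *_) (ℤ.i≡j⇒i-j≡0 weighted) ⟩
            p * p * p * 0ℤ
              ≡⟨ ℤ.*-zeroʳ (p * p * p) ⟩
            0ℤ
              ∎))))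

-b≢0 : ∀ {b₁ b₂} → ¬ b₁ ∷ b₂ ∷ [] ≡ 0ℤ ∷ 0ℤ ∷ [] → ¬ (- b₁ , - b₂) ≡ (0ℤ , 0ℤ)
-b≢0 {b₁} {b₂} b≢0 -b≡0 = b≢0 (cong₂ (λ u w → u ∷ w ∷ [])
  (ℤ.neg-injective (cong proj₁ -b≡0)) (ℤ.neg-injective (cong proj₂ -b≡0)))

admissible-of-small : ∀ P Q → +[1+ P ] * +[1+ Q ] < + 4 →
  ∀ b₁ b₂ → ¬ (b₁ ≡ 0ℤ × b₂ ≡ 0ℤ) → Admissible (rank2 P Q) (b₁ ∷ b₂ ∷ [])
admissible-of-small P Q pq<4 b₁ b₂ b≢0 =
  (λ b≡0 → b≢0 (∷-injectiveˡ b≡0 , ∷-injectiveˡ (∷-injectiveʳ b≡0))) ,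
  finite-of-small P Q pq<4 (- b₁ , - b₂)

admissible⇔weighted : ∀ P Q E₁ E₂ → +[1+ P ] * +[1+ Q ] ≡ + 4 →
  +[1+ Q ] * +[1+ E₁ ] ≡ +[1+ P ] * +[1+ E₂ ] →
  ∀ b₁ b₂ → Admissible (rank2 P Q) (b₁ ∷ b₂ ∷ []) ⇔
    (b₁ ≤ 0ℤ × 0ℤ ≤ b₂ × +[1+ E₁ ] * (b₁ * b₁) ≡ +[1+ E₂ ] * (b₂ * b₂) × ¬ (b₁ ∷ b₂ ∷ [] ≡ 0ℤ ∷ 0ℤ ∷ []))
admissible⇔weighted P Q E₁ E₂ pq≡4 qd₁≡pd₂ b₁ b₂ = mk⇔
  (λ (b≢0 , finite) → let b₁≤0 , 0≤b₂ , weighted = to balanced⇔weighted (to finite⇔balanced finite)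
                      in b₁≤0 , 0≤b₂ , weighted , b≢0)
  (λ (b₁≤0 , 0≤b₂ , weighted , b≢0) →
    b≢0 , from finite⇔balanced (from balanced⇔weighted (b₁≤0 , 0≤b₂ , weighted)))
  where
  open Equivalence
  finite⇔balanced : FiniteMutationClass (extended P Q (- b₁ , - b₂)) ⇔ Balanced +[1+ P ] (- b₁ , - b₂)
  finite⇔balanced = Classification.finite⇔balanced P Q pq≡4 (- b₁ , - b₂)
  balanced⇔weighted : Balanced +[1+ P ] (- b₁ , - b₂) ⇔
                      (b₁ ≤ 0ℤ × 0ℤ ≤ b₂ × +[1+ E₁ ] * (b₁ * b₁) ≡ +[1+ E₂ ] * (b₂ * b₂))
  balanced⇔weighted = Weights.Balanced⇔weighted P Q E₁ E₂ pq≡4 qd₁≡pd₂ b₁ b₂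

not-admissible-of-large : ∀ P Q → +[1+ P ] * +[1+ Q ] > + 4 → ∀ b → ¬ Admissible (rank2 P Q) b
not-admissible-of-large P Q pq>4 (b₁ ∷ b₂ ∷ []) (b≢0 , finite) =
  Classification.infinite-of-large P Q (ℤ.i<j⇒suc[i]≤j pq>4) (- b₁ , - b₂) (-b≢0 b≢0) finite

theorem9p3 : (B : Mat 2 2) (d₁ d₂ : ℤ) →
    IsSkewSymmetrizer B (d₁ ∷ d₂ ∷ []) →
    entry B zero (suc zero) > 0ℤ →
    let a = - (entry B zero (suc zero) * entry B (suc zero) zero) in
    (a < + 4 → ∀ (b₁ b₂ : ℤ) → ¬ (b₁ ≡ 0ℤ × b₂ ≡ 0ℤ) → Admissible B (b₁ ∷ b₂ ∷ [])) ×
    (a ≡ + 4 → ∀ (b₁ b₂ : ℤ) →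
      Admissible B (b₁ ∷ b₂ ∷ []) ⇔
        (b₁ ≤ 0ℤ × 0ℤ ≤ b₂ × d₁ * (b₁ * b₁) ≡ d₂ * (b₂ * b₂) × ¬ (b₁ ∷ b₂ ∷ [] ≡ 0ℤ ∷ 0ℤ ∷ []))) ×
    (a > + 4 → ∀ (b : Vec ℤ 2) → ¬ Admissible B b)
theorem9p3 B d₁ d₂ skewSymmetrizer b₁₂>0 with rank2-shape B d₁ d₂ skewSymmetrizer b₁₂>0
... | P , Q , E₁ , E₂ , refl , refl , refl =
  admissible-of-small P Q ,
  (λ pq≡4 → admissible⇔weighted P Q E₁ E₂ pq≡4 qd₁≡pd₂) ,
  not-admissible-of-large P Q
  where
  qd₁≡pd₂ : +[1+ Q ] * +[1+ E₁ ] ≡ +[1+ P ] * +[1+ E₂ ]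
  qd₁≡pd₂ = ℤ.neg-injective
    (trans (ℤ.neg-distribˡ-* +[1+ Q ] +[1+ E₁ ]) (proj₂ skewSymmetrizer (suc zero) zero))
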